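{- Let $n\in\mathbb{N}\cup\{\infty\}$, let $V$ be a type with an equivalence $\sup:\mathsf{T}^n_U V\simeq V$, equipped with the induced relation $y\in x:=\mathrm{fib}\,\widetilde{x}\,y$. Let $k\in\mathbb{N}\cup\{\infty\}$ with $k\le n$, and suppose $V$ is $(k+1)$-locally $U$-small. Then $(V,\in)$ has $k$-replacement: for every $a:V$ and $f:\mathrm{El}\,a\to V$ there is $b:V$ such that for all $z:V$, $z\in b\simeq \big\|\sum_{x:\mathrm{El}\,a}f\,x=z\big\|_{k-1}$.
   Context: Homotopy type theory with univalent universes $U:\mathsf{Type}$, function extensionality; $\|-\|_j$ is $j$-truncation, with $\|P\|_\infty:=P$ and $\infty\pm1=\infty$. A map is $j$-truncated if its homotopy fibers are $j$-types; $A\hookrightarrow_j X$ is the type of $j$-truncated maps; $\mathsf{T}^n_U X:=\sum_{A:U}(A\hookrightarrow_{n-1}X)$. For $x:V$ write $\sup^{ -1}x=(\overline{x},\widetilde{x})$ with $\overline{x}:U$, $\widetilde{x}:\overline{x}\hookrightarrow_{n-1}V$; $\mathrm{fib}\,g\,y:=\sum_a g\,a=y$, and $\mathrm{El}\,a:=\sum_{x:V}x\in a$. A type is essentially $U$-small if equivalent to a type in $U$; $0$-locally $U$-small means essentially $U$-small, $(j+1)$-locally $U$-small means all identity types are $j$-locally $U$-small, and every type is $\infty$-locally $U$-small. Standing assumption (small images): for every $A:U$, every $1$-locally $U$-small type $X$ and $f:A\to X$ there is $\mathrm{im}\,f:U$ with a surjection $A\twoheadrightarrow\mathrm{im}\,f$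 and an embedding $\mathrm{im}\,f\hookrightarrow X$ composing definitionally to $f$. -}

{-# OPTIONS --without-K #-}
module Defs where

open import Level using (Level; _⊔_; Setω) renaming (suc to lsuc)
open import Data.Nat using (ℕ; zero; suc; _≤_)
open import Data.Product using (Σ; _,_; proj₁; proj₂; _×_)
open import Data.Unit.Polymorphic using (⊤)
open import Data.Empty.Polymorphic using (⊥)
open import Relation.Binary.PropositionalEquality using (_≡_; refl)

isContr : ∀ {a} → Set a → Set a
isContr A = Σ A λ c → ∀ x → c ≡ x

-- h-levels, numbered from 0 (contractible), 1 = propositions, 2 = sets, ...
-- so an h-level (m) type is an (m-2)-type.
isHLevel : ∀ {a} → ℕ → Set a → Set a
isHLevel zero A = isContr A
isHLevel (suc m) A = (x y : A) → isHLevel m (x ≡ y)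

isProp : ∀ {a} → Set a → Set a
isProp = isHLevel 1

fib : ∀ {a b} {A : Set a} {B : Set b} → (A → B) → B → Set (a ⊔ b)
fib {A = A} g y = Σ A λ x → g x ≡ y

isEquiv : ∀ {a b} {A : Set a} {B : Set b} → (A → B) → Set (a ⊔ b)
isEquiv {B = B} g = (y : B) → isContr (fib g y)

_≃_ : ∀ {a b} → Set a → Set b → Set (a ⊔ b)
A ≃ B = Σ (A → B) isEquiv

data ℕ∞ : Set where
  fin : ℕ → ℕ∞
  ∞   : ℕ∞

_≤∞_ : ℕ∞ → ℕ∞ → Set
fin a ≤∞ fin b = a ≤ b
fin a ≤∞ ∞     = ⊤
∞     ≤∞ fin b = ⊥
∞     ≤∞ ∞     = ⊤

-- "A is a (j-1)-type" for j : ℕ∞ (every type is an ∞-type).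
-- A (m-1)-type is a type of h-level (m+1).
is[_-1]Type : ∀ {a} → ℕ∞ → Set a → Set a
is[ fin m -1]Type A = isHLevel (suc m) A
is[ ∞ -1]Type A = ⊤

_↪[_-1]_ : ∀ {a x} → Set a → ℕ∞ → Set x → Set (a ⊔ x)
A ↪[ j -1] X = Σ (A → X) λ g → (y : X) → is[ j -1]Type (fib g y)

idtoeqv : ∀ {a} {A B : Set a} → A ≡ B → A ≃ B
idtoeqv refl = (λ x → x) , λ y → (y , refl) , λ { (x , refl) → refl }

Univalence : Setω
Univalence = ∀ {a} (A B : Set a) → isEquiv (idtoeqv {A = A} {B = B})

happly : ∀ {a b} {A : Set a} {B : A → Set b} {f g : (x : A) → B x} → f ≡ g → (x : A) → f x ≡ g x
happly refl x = refl

FunExt : Setω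
FunExt = ∀ {a b} {A : Set a} {B : A → Set b} (f g : (x : A) → B x) → isEquiv (happly {f = f} {g = g})

-- Truncations: ‖ A ‖ at h-level (suc m), i.e. the (m-1)-truncation,
-- given by its universal property.
record Truncations : Setω where
  field
    ∥_∥⟨_⟩   : ∀ {a} → Set a → ℕ → Set a
    ∣_∣⟨_⟩   : ∀ {a} {A : Set a} → A → (m : ℕ) → ∥ A ∥⟨ m ⟩
    trunc-level : ∀ {a} (A : Set a) (m : ℕ) → isHLevel (suc m) ∥ A ∥⟨ m ⟩
    trunc-up : ∀ {a b} (A : Set a) (m : ℕ) (B : Set b) → isHLevel (suc m) B →
               isEquiv (λ (g : ∥ A ∥⟨ m ⟩ → B) → λ x → g ∣ x ∣⟨ m ⟩)
open Truncations public

Trunc[_-1] : ∀ {a} → Truncations → ℕ∞ → Set a → Set a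
Trunc[ T -1] (fin m) A = ∥_∥⟨_⟩ T A m
Trunc[ T -1] ∞ A = A

-- Universe U is Set ℓ.
-- j-locally U-small types (j : ℕ∞)
LocSmall : ∀ (ℓ : Level) {x} → ℕ∞ → Set x → Set (lsuc ℓ ⊔ x)
LocSmall ℓ (fin zero) X = Σ (Set ℓ) λ B → B ≃ X
LocSmall ℓ (fin (suc j)) X = (x y : X) → LocSmall ℓ (fin j) (x ≡ y)
LocSmall ℓ ∞ X = ⊤

isSurj : ∀ {a b} → Truncations → {A : Set a} {B : Set b} → (A → B) → Set (a ⊔ b)
isSurj T {B = B} g = (y : B) → ∥_∥⟨_⟩ T (fib g y) 0

isEmb : ∀ {a b} {A : Set a} {B : Set b} → (A → B) → Set (a ⊔ b)
isEmb {B = B} g = (y : B) → isProp (fib g y)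

-- Standing assumption: small images (for the universe Set ℓ)
SmallImages : Truncations → Level → Setω
SmallImages T ℓ = ∀ {x} (A : Set ℓ) (X : Set x) → LocSmall ℓ (fin 1) X → (f : A → X) →
  Σ (Set ℓ) λ I → Σ (A → I) λ s → Σ (I → X) λ e →
    isSurj T s × isEmb e × ((a : A) → e (s a) ≡ f a)

Tⁿ : ∀ (ℓ : Level) {x} → ℕ∞ → Set x → Set (lsuc ℓ ⊔ x)
Tⁿ ℓ n X = Σ (Set ℓ) λ A → A ↪[ n -1] X

module _ {ℓ ℓV : Level} {n : ℕ∞} {V : Set ℓV} (sup : (Tⁿ ℓ n V) ≃ V) where

  sup⁻¹ : V → Tⁿ ℓ n V
  sup⁻¹ x = proj₁ (proj₁ (proj₂ sup x))

  _∈_ : V → V → Set (ℓ ⊔ ℓV)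
  y ∈ x = fib (proj₁ (proj₂ (sup⁻¹ x))) y

  El : V → Set (ℓ ⊔ ℓV)
  El a = Σ V λ x → x ∈ a

suc∞ : ℕ∞ → ℕ∞
suc∞ (fin m) = fin (suc m)
suc∞ ∞ = ∞

HasReplacement : ∀ {ℓ ℓV} (n : ℕ∞) (V : Set ℓV) → Truncations → (sup : (Tⁿ ℓ n V) ≃ V) → ℕ∞ → Set (ℓ ⊔ ℓV)
HasReplacement {ℓ} {ℓV} n V Tr sup k =
  (a : V) (f : El {ℓ} {ℓV} {n} {V} sup a → V) → Σ V λ b → (z : V) →
    (_∈_ {ℓ} {ℓV} {n} {V} sup z b) ≃ Trunc[ Tr -1] k (Σ (El {ℓ} {ℓV} {n} {V} sup a) λ x → f x ≡ z)

{-# OPTIONS --safe --without-K #-}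
-- Let f̃ : ā → V be f precomposed with the index map ā ≃ El a. For k = ∞ take
-- b := sup (ā , f̃), so that z ∈ b is the fibre of f̃, i.e. of f, over z. For finite
-- k take b := sup (I , g), where I is a small type equivalent to the (k-1)-image
-- Σ (z : V) ∥ fib f̃ z ∥_{k-1} and g is the first projection. That image is
-- essentially small by induction on k: for k = 0 this is the small-images axiom;
-- in the step, paths ι x ≡ ι x′ between points of the image are equivalent
-- (encode–decode for truncations) to points of the (k-2)-image of
-- cong f̃ : (x ≡ x′) → (f̃ x ≡ f̃ x′), small by induction, so the image is
-- 1-locally small and the small image of ι : ā → image is all of it.
module Submission where

open import Level using (Level; _⊔_; lift) renaming (suc to lsuc)
open import Data.Nat using (ℕ; zero; suc; _≤_; z≤n; s≤s)
open import Data.Product using (Σ; _,_; proj₁; proj₂; _×_)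
open import Data.Product.Properties using (Σ-≡,≡→≡; Σ-≡,≡←≡; Σ-≡,≡↔≡)
open import Data.Product.Function.Dependent.Propositional using (Σ-↔)
open import Data.Unit.Polymorphic using (tt)
open import Function using (_∘_; _↔_; mk↔ₛ′; Inverse)
open import Function.Properties.Inverse using (↔-refl; ↔-sym; ↔-trans)
open import Function.Related.Propositional using (module EquationalReasoning)
open import Relation.Binary.PropositionalEquality using (_≡_; refl; sym; trans; cong; subst; module ≡-Reasoning)
open import Relation.Binary.PropositionalEquality.Properties using (trans-symˡ)
open import Defs

private variable
  a b c : Level
  A : Set a
  B : Set b
  C : Set c

record _◁_ (A : Set a) (B : Set b) : Set (a ⊔ b) where
  field
    section            : A → B
    retraction         : B → A
    retraction∘section : ∀ x → retraction (section x) ≡ x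
open _◁_

◁-trans : A ◁ B → B ◁ C → A ◁ C
◁-trans ρ σ = record
  { section            = section σ ∘ section ρ
  ; retraction         = retraction ρ ∘ retraction σ
  ; retraction∘section = λ x → trans (cong (retraction ρ) (retraction∘section σ (section ρ x)))
                                     (retraction∘section ρ x)
  }

↔⇒◁ : A ↔ B → A ◁ B
↔⇒◁ e = record
  { section = Inverse.to e ; retraction = Inverse.from e ; retraction∘section = Inverse.strictlyInverseʳ e }

Σ-◁ : {P : A → Set b} {Q : A → Set c} → (∀ x → P x ◁ Q x) → Σ A P ◁ Σ A Q
Σ-◁ ρ = record
  { section            = λ (x , p) → x , section (ρ x) p
  ; retraction         = λ (x , q) → x , retraction (ρ x) q
  ; retraction∘section = λ (x , p) → cong (x ,_) (retraction∘section (ρ x) p)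
  }

≡-◁ : (ρ : A ◁ B) {x y : A} → (x ≡ y) ◁ (section ρ x ≡ section ρ y)
≡-◁ ρ {x} {y} = record
  { section            = cong (section ρ)
  ; retraction         = λ q → trans (sym (rs x)) (trans (cong (retraction ρ) q) (rs y))
  ; retraction∘section = λ { refl → trans-symˡ (rs x) }
  }
  where rs = retraction∘section ρ

isContr-◁ : A ◁ B → isContr B → isContr A
isContr-◁ ρ (c , h) = retraction ρ c , λ x → trans (cong (retraction ρ) (h (section ρ x))) (retraction∘section ρ x)

singleton-isContr : (y : A) → isContr (Σ A λ x → x ≡ y)
singleton-isContr y = (y , refl) , λ { (_ , refl) → refl }

≡-pre-↔ : {x x′ y : A} → x ≡ x′ → (x ≡ y) ↔ (x′ ≡ y)
≡-pre-↔ refl = ↔-refl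

sym-↔ : {x y : A} → (x ≡ y) ↔ (y ≡ x)
sym-↔ = mk↔ₛ′ sym sym (λ { refl → refl }) (λ { refl → refl })

-- `to x ≡ y` is a retract of `x ≡ from y`, so every fibre of `to` is a retract
-- of a singleton; no half-adjoint coherence is needed.
↔⇒≃ : A ↔ B → A ≃ B
↔⇒≃ {A = A} {B = B} e = to , λ y → isContr-◁ (Σ-◁ λ x → fibre-◁ x y) (singleton-isContr (from y))
  where
    open Inverse e
    B◁A : B ◁ A
    B◁A = record { section = from ; retraction = to ; retraction∘section = strictlyInverseˡ }
    fibre-◁ : ∀ x y → (to x ≡ y) ◁ (x ≡ from y)
    fibre-◁ x y = ◁-trans (≡-◁ B◁A) (↔⇒◁ (≡-pre-↔ (strictlyInverseʳ x)))

≃⇒↔ : A ≃ B → A ↔ B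
≃⇒↔ (f , f-eqv) = mk↔ₛ′ f (λ y → proj₁ (proj₁ (f-eqv y))) (λ y → proj₂ (proj₁ (f-eqv y)))
                        (λ x → cong proj₁ (proj₂ (f-eqv (f x)) (x , refl)))

≃-trans : A ≃ B → B ≃ C → A ≃ C
≃-trans e e′ = ↔⇒≃ (↔-trans (≃⇒↔ e) (≃⇒↔ e′))

≃-sym : A ≃ B → B ≃ A
≃-sym e = ↔⇒≃ (↔-sym (≃⇒↔ e))

subst-↔ : (P : A → Set b) {x y : A} → x ≡ y → P x ↔ P y
subst-↔ P refl = ↔-refl

fib-proj₁-↔ : {P : A → Set b} (x : A) → fib (proj₁ {B = P}) x ↔ P x
fib-proj₁-↔ {P = P} x = mk↔ₛ′ (λ ((_ , p) , q) → subst P q p) (λ p → (x , p) , refl)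
                              (λ _ → refl) (λ { (_ , refl) → refl })

total-fib-↔ : (g : A → B) → A ↔ Σ B (fib g)
total-fib-↔ g = mk↔ₛ′ (λ x → g x , x , refl) (λ (_ , x , _) → x) (λ { (_ , _ , refl) → refl }) (λ _ → refl)

fib-∘-↔ : (e : A ↔ B) (f : B → C) (z : C) → fib (f ∘ Inverse.to e) z ↔ fib f z
fib-∘-↔ e f z = Σ-↔ e ↔-refl

fib-proj₁∘-↔ : {X : Set b} {P : X → Set c} (φ : A ≃ Σ X P) (z : X) → fib (proj₁ ∘ proj₁ φ) z ↔ P z
fib-proj₁∘-↔ φ z = ↔-trans (fib-∘-↔ (≃⇒↔ φ) proj₁ z) (fib-proj₁-↔ z)

Σ-isContr-↔ : {P : A → Set b} → (∀ x → isContr (P x)) → Σ A P ↔ A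
Σ-isContr-↔ h = mk↔ₛ′ proj₁ (λ x → x , proj₁ (h x)) (λ _ → refl) (λ (x , p) → cong (x ,_) (proj₂ (h x) p))

isHLevel-◁ : ∀ n → A ◁ B → isHLevel n B → isHLevel n A
isHLevel-◁ zero    ρ h = isContr-◁ ρ h
isHLevel-◁ (suc n) ρ h x y = isHLevel-◁ n (≡-◁ ρ) (h _ _)

isHLevel-↔ : ∀ n → A ↔ B → isHLevel n B → isHLevel n A
isHLevel-↔ n e = isHLevel-◁ n (↔⇒◁ e)

isContr⇒≡ : isContr A → (x y : A) → x ≡ y
isContr⇒≡ (_ , h) x y = trans (sym (h x)) (h y)

isContr⇒≡-isContr : isContr A → (x y : A) → isContr (x ≡ y)
isContr⇒≡-isContr c@(_ , h) x y = isContr⇒≡ c x y , λ { refl → trans-symˡ (h x) }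

subst-sym-elim : (P : A → Set b) {x y : A} (q : x ≡ y) {R : P x → Set c} →
  ((p : P y) → R (subst P (sym q) p)) → ∀ p → R p
subst-sym-elim P refl h = h

total-isContr⇒≡↔ : {Q : A → Set b} (x₀ : A) (q₀ : Q x₀) → isContr (Σ A Q) → ∀ x → (x₀ ≡ x) ↔ Q x
total-isContr⇒≡↔ {Q = Q} x₀ q₀ c x = mk↔ₛ′ (λ p → subst Q p q₀) decode
  (λ q → proj₂ (Σ-≡,≡←≡ (centre-path q)))
  (λ { refl → cong (proj₁ ∘ Σ-≡,≡←≡) (trans-symˡ (proj₂ c (x₀ , q₀))) })
  where
    centre-path : (q : Q x) → (x₀ , q₀) ≡ (x , q)
    centre-path q = isContr⇒≡ c (x₀ , q₀) (x , q)
    decode : Q x → x₀ ≡ x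
    decode q = proj₁ (Σ-≡,≡←≡ (centre-path q))

isHLevel-suc : ∀ n → isHLevel n A → isHLevel (suc n) A
isHLevel-suc zero    h = isContr⇒≡-isContr h
isHLevel-suc (suc n) h x y = isHLevel-suc n (h x y)

isProp⇒isHLevel-suc : ∀ n → isProp A → isHLevel (suc n) A
isProp⇒isHLevel-suc zero    h = h
isProp⇒isHLevel-suc (suc n) h = isHLevel-suc (suc n) (isProp⇒isHLevel-suc n h)

isHLevel-suc-mono : ∀ {m n} → m ≤ n → isHLevel (suc m) A → isHLevel (suc n) A
isHLevel-suc-mono {n = n} z≤n h = isProp⇒isHLevel-suc n h
isHLevel-suc-mono (s≤s m≤n) h x y = isHLevel-suc-mono m≤n (h x y)

isHLevel-suc⇒is[-1]Type : ∀ {m} n → fin m ≤∞ n → isHLevel (suc m) A → is[ n -1]Type A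
isHLevel-suc⇒is[-1]Type (fin _) m≤n h = isHLevel-suc-mono m≤n h
isHLevel-suc⇒is[-1]Type ∞       _   _ = tt

inhabited⇒isContr⇒isProp : (A → isContr A) → isProp A
inhabited⇒isContr⇒isProp h x = isContr⇒≡-isContr (h x) x

isProp⇒≡ : isProp A → (x y : A) → x ≡ y
isProp⇒≡ h x y = proj₁ (h x y)

isProp⇒inhabited⇒isContr : isProp A → A → isContr A
isProp⇒inhabited⇒isContr h x = x , isProp⇒≡ h x

isProp-↔ : isProp A → isProp B → (A → B) → (B → A) → A ↔ B
isProp-↔ hA hB f g = mk↔ₛ′ f g (λ _ → isProp⇒≡ hB _ _) (λ _ → isProp⇒≡ hA _ _)

Σ-isHLevel : {P : A → Set b} → ∀ n → isHLevel n A → (∀ x → isHLevel n (P x)) → isHLevel n (Σ A P)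
Σ-isHLevel zero c@(x₀ , h) hP =
  (x₀ , proj₁ (hP x₀)) , λ (x , p) → Σ-≡,≡→≡ (h x , isContr⇒≡ (hP x) _ p)
Σ-isHLevel (suc n) hA hP x y =
  isHLevel-↔ n (↔-sym Σ-≡,≡↔≡) (Σ-isHLevel n (hA _ _) λ _ → hP _ _ _)

Σ-≡-↔-proj₁-≡ : {P : A → Set b} → (∀ x → isProp (P x)) → {u v : Σ A P} → (u ≡ v) ↔ (proj₁ u ≡ proj₁ v)
Σ-≡-↔-proj₁-≡ hP = ↔-trans (↔-sym Σ-≡,≡↔≡) (Σ-isContr-↔ λ _ → hP _ _ _)

module FunExtConsequences (fe : FunExt) where

  funext : {P : A → Set b} {f g : (x : A) → P x} → (∀ x → f x ≡ g x) → f ≡ g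
  funext {f = f} {g} = Inverse.from (≃⇒↔ (happly , fe f g))

  Π-isHLevel : {P : A → Set b} → ∀ n → (∀ x → isHLevel n (P x)) → isHLevel n ((x : A) → P x)
  Π-isHLevel zero    h = (λ x → proj₁ (h x)) , λ f → funext λ x → proj₂ (h x) (f x)
  Π-isHLevel (suc n) h f g = isHLevel-↔ n (≃⇒↔ (happly , fe f g)) (Π-isHLevel n λ x → h x (f x) (g x))

  isContr-isProp : isProp (isContr A)
  isContr-isProp = inhabited⇒isContr⇒isProp λ c →
    Σ-isHLevel 0 c λ x → Π-isHLevel 0 λ y → isContr⇒≡-isContr c x y

  isHLevel-isProp : ∀ n → isProp (isHLevel n A)
  isHLevel-isProp zero    = isContr-isProp
  isHLevel-isProp (suc n) = Π-isHLevel 1 λ _ → Π-isHLevel 1 λ _ → isHLevel-isProp n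

  isEquiv-isProp : {f : A → B} → isProp (isEquiv f)
  isEquiv-isProp = Π-isHLevel 1 λ _ → isContr-isProp

  ≃-≡ : {e e′ : A ≃ B} → (∀ x → proj₁ e x ≡ proj₁ e′ x) → e ≡ e′
  ≃-≡ h = Σ-≡,≡→≡ (funext h , isProp⇒≡ isEquiv-isProp _ _)

  ≃-trans-↔ : B ≃ C → (A ≃ B) ↔ (A ≃ C)
  ≃-trans-↔ e = mk↔ₛ′ (λ h → ≃-trans h e) (λ h → ≃-trans h (≃-sym e))
    (λ h → ≃-≡ λ x → Inverse.strictlyInverseˡ (≃⇒↔ e) (proj₁ h x))
    (λ h → ≃-≡ λ x → Inverse.strictlyInverseʳ (≃⇒↔ e) (proj₁ h x))

module UnivalenceConsequences (fe : FunExt) (univ : Univalence) where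
  open FunExtConsequences fe

  ≡↔≃ : {X Y : Set a} → (X ≡ Y) ↔ (X ≃ Y)
  ≡↔≃ {X = X} {Y} = ≃⇒↔ (idtoeqv , univ X Y)

  EssSmall-isProp : ∀ ℓ {Y : Set b} → isProp (Σ (Set ℓ) λ S → S ≃ Y)
  EssSmall-isProp ℓ = inhabited⇒isContr⇒isProp λ (S₀ , e₀) →
    isContr-◁ (Σ-◁ λ S → ↔⇒◁ (↔-trans (≃-trans-↔ (≃-sym e₀)) (↔-sym ≡↔≃))) (singleton-isContr S₀)

  HLevelType : ∀ ℓ → ℕ → Set (lsuc ℓ)
  HLevelType ℓ n = Σ (Set ℓ) (isHLevel (suc n))

  HLevelType-isHLevel : ∀ ℓ n → isHLevel (suc (suc n)) (HLevelType ℓ n)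
  HLevelType-isHLevel ℓ n (X , _) (Y , hY) =
    isHLevel-↔ (suc n) (↔-trans (Σ-≡-↔-proj₁-≡ λ _ → isHLevel-isProp (suc n)) ≡↔≃)
      (Σ-isHLevel (suc n) (Π-isHLevel (suc n) λ _ → hY) λ _ → isProp⇒isHLevel-suc n isEquiv-isProp)

module TruncationProperties (fe : FunExt) (univ : Univalence) (Tr : Truncations) where
  open FunExtConsequences fe
  open UnivalenceConsequences fe univ

  ∥_∥[_] : Set a → ℕ → Set a
  ∥ A ∥[ m ] = ∥_∥⟨_⟩ Tr A m

  ∣_∣[_] : A → (m : ℕ) → ∥ A ∥[ m ]
  ∣ x ∣[ m ] = ∣_∣⟨_⟩ Tr x m

  ∥∥-isHLevel : (A : Set a) (m : ℕ) → isHLevel (suc m) ∥ A ∥[ m ]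
  ∥∥-isHLevel = trunc-level Tr

  private
    ∥∥-up : ∀ m {A : Set a} → isHLevel (suc m) B → (∥ A ∥[ m ] → B) ↔ (A → B)
    ∥∥-up m {A} hB = ≃⇒↔ (_ , trunc-up Tr A m _ hB)

  ∥∥-rec : ∀ m → isHLevel (suc m) B → (A → B) → ∥ A ∥[ m ] → B
  ∥∥-rec m hB = Inverse.from (∥∥-up m hB)

  ∥∥-rec-β : ∀ m (hB : isHLevel (suc m) B) (g : A → B) (x : A) → ∥∥-rec m hB g ∣ x ∣[ m ] ≡ g x
  ∥∥-rec-β m hB g = happly (Inverse.strictlyInverseˡ (∥∥-up m hB) g)

  ∥∥-ext : ∀ m → isHLevel (suc m) B → (h h′ : ∥ A ∥[ m ] → B) →
    (∀ x → h ∣ x ∣[ m ] ≡ h′ ∣ x ∣[ m ]) → ∀ t → h t ≡ h′ t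
  ∥∥-ext m hB h h′ h≗h′ = happly (begin
    h                                  ≡⟨ sym (strictlyInverseʳ h) ⟩
    from (λ x → h ∣ x ∣[ m ])          ≡⟨ cong from (funext h≗h′) ⟩
    from (λ x → h′ ∣ x ∣[ m ])         ≡⟨ strictlyInverseʳ h′ ⟩
    h′                                 ∎)
    where
      open Inverse (∥∥-up m hB)
      open ≡-Reasoning

  ∥∥-elim : ∀ m (P : ∥ A ∥[ m ] → Set b) → (∀ t → isHLevel (suc m) (P t)) →
    (∀ x → P ∣ x ∣[ m ]) → ∀ t → P t
  ∥∥-elim {A = A} m P hP d t = subst P (proj₁-elim-Σ t) (proj₂ (elim-Σ t))
    where
      hΣ : isHLevel (suc m) (Σ ∥ A ∥[ m ] P)
      hΣ = Σ-isHLevel (suc m) (∥∥-isHLevel A m) hP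
      elim-Σ : ∥ A ∥[ m ] → Σ ∥ A ∥[ m ] P
      elim-Σ = ∥∥-rec m hΣ λ x → ∣ x ∣[ m ] , d x
      proj₁-elim-Σ : ∀ t → proj₁ (elim-Σ t) ≡ t
      proj₁-elim-Σ = ∥∥-ext m (∥∥-isHLevel A m) (proj₁ ∘ elim-Σ) (λ t → t) λ x → cong proj₁ (∥∥-rec-β m hΣ _ x)

  ∥∥-map : ∀ m → (A → B) → ∥ A ∥[ m ] → ∥ B ∥[ m ]
  ∥∥-map m g = ∥∥-rec m (∥∥-isHLevel _ m) λ x → ∣ g x ∣[ m ]

  ∥∥-map-β : ∀ m (g : A → B) (x : A) → ∥∥-map m g ∣ x ∣[ m ] ≡ ∣ g x ∣[ m ]
  ∥∥-map-β m g = ∥∥-rec-β m (∥∥-isHLevel _ m) _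

  ∥∥-map-inverse : ∀ m (g : A → B) (h : B → A) → (∀ x → h (g x) ≡ x) →
    ∀ t → ∥∥-map m h (∥∥-map m g t) ≡ t
  ∥∥-map-inverse m g h h∘g = ∥∥-ext m (∥∥-isHLevel _ m) _ (λ t → t) λ x → begin
    ∥∥-map m h (∥∥-map m g ∣ x ∣[ m ])  ≡⟨ cong (∥∥-map m h) (∥∥-map-β m g x) ⟩
    ∥∥-map m h ∣ g x ∣[ m ]             ≡⟨ ∥∥-map-β m h (g x) ⟩
    ∣ h (g x) ∣[ m ]                    ≡⟨ cong ∣_∣[ m ] (h∘g x) ⟩
    ∣ x ∣[ m ]                          ∎
    where open ≡-Reasoning

  ∥∥-cong-↔ : ∀ m → A ↔ B → ∥ A ∥[ m ] ↔ ∥ B ∥[ m ]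
  ∥∥-cong-↔ m e = mk↔ₛ′ (∥∥-map m to) (∥∥-map m from)
    (∥∥-map-inverse m from to strictlyInverseˡ) (∥∥-map-inverse m to from strictlyInverseʳ)
    where open Inverse e

  -- Encode–decode: the family ∣ y ∣ ↦ ∥ x ≡ y ∥ extends to ∥ A ∥[ suc m ] because
  -- (m-1)-types form an m-type, and its total space is contractible.
  ∣∣-≡↔ : ∀ m (x y : A) → (∣ x ∣[ suc m ] ≡ ∣ y ∣[ suc m ]) ↔ ∥ x ≡ y ∥[ m ]
  ∣∣-≡↔ {a} {A = A} m x y =
    ↔-trans (total-isContr⇒≡↔ ∣ x ∣[ suc m ] code-refl total-isContr ∣ y ∣[ suc m ])
            (subst-↔ proj₁ (code-β y))
    where
      code : ∥ A ∥[ suc m ] → HLevelType a m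
      code = ∥∥-rec (suc m) (HLevelType-isHLevel a m) λ y → ∥ x ≡ y ∥[ m ] , ∥∥-isHLevel _ m
      Code : ∥ A ∥[ suc m ] → Set a
      Code = proj₁ ∘ code
      code-β : ∀ y → code ∣ y ∣[ suc m ] ≡ (∥ x ≡ y ∥[ m ] , ∥∥-isHLevel _ m)
      code-β = ∥∥-rec-β (suc m) (HLevelType-isHLevel a m) _
      code-refl : Code ∣ x ∣[ suc m ]
      code-refl = subst proj₁ (sym (code-β x)) ∣ refl ∣[ m ]
      total-isHLevel : isHLevel (suc (suc m)) (Σ ∥ A ∥[ suc m ] Code)
      total-isHLevel = Σ-isHLevel (suc (suc m)) (∥∥-isHLevel A (suc m)) λ v → isHLevel-suc (suc m) (proj₂ (code v))
      contraction : ∀ v (c : Code v) → (∣ x ∣[ suc m ] , code-refl) ≡ (v , c)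
      contraction = ∥∥-elim (suc m) _ (λ _ → Π-isHLevel _ λ _ → isHLevel-suc (suc m) (total-isHLevel _ _)) λ y →
        subst-sym-elim proj₁ (code-β y) (∥∥-elim m _ (λ _ → total-isHLevel _ _) λ { refl → refl })
      total-isContr : isContr (Σ ∥ A ∥[ suc m ] Code)
      total-isContr = (∣ x ∣[ suc m ] , code-refl) , λ (v , c) → contraction v c

module Images (fe : FunExt) (univ : Univalence) (Tr : Truncations) {ℓ : Level} (SI : SmallImages Tr ℓ) where
  open FunExtConsequences fe
  open UnivalenceConsequences fe univ
  open TruncationProperties fe univ Tr

  EssSmall : Set b → Set (lsuc ℓ ⊔ b)
  EssSmall = LocSmall ℓ (fin 0)

  EssSmall-↔ : A ↔ B → EssSmall A → EssSmall B
  EssSmall-↔ e (S , φ) = S , ↔⇒≃ (↔-trans (≃⇒↔ φ) e)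

  Image : ℕ → {X : Set b} {A : Set ℓ} → (A → X) → Set (ℓ ⊔ b)
  Image m {X} f = Σ X λ z → ∥ fib f z ∥[ m ]

  SmallImage : {X : Set b} {A : Set ℓ} → (A → X) → Set (lsuc ℓ ⊔ b)
  SmallImage {X = X} {A} f =
    Σ (Set ℓ) λ I → Σ (A → I) λ s → Σ (I → X) λ e → isSurj Tr s × isEmb e × (∀ x → e (s x) ≡ f x)

  SmallImage⇒propImage-isEssSmall : {X : Set b} {A : Set ℓ} {f : A → X} → SmallImage f → EssSmall (Image 0 f)
  SmallImage⇒propImage-isEssSmall {f = f} (I , s , e , s-surj , e-emb , e∘s≡f) =
    I , ↔⇒≃ (↔-trans (total-fib-↔ e) (Σ-↔ ↔-refl fib-e↔∥fib-f∥))
    where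
      fib-e↔∥fib-f∥ : ∀ {z} → fib e z ↔ ∥ fib f z ∥[ 0 ]
      fib-e↔∥fib-f∥ {z} = isProp-↔ (e-emb z) (∥∥-isHLevel _ 0)
        (λ (i , q) → ∥∥-map 0 (λ (x , p) → x , trans (sym (e∘s≡f x)) (trans (cong e p) q)) (s-surj i))
        (∥∥-rec 0 (e-emb z) λ (x , p) → s x , trans (e∘s≡f x) p)

  module _ {X : Set b} {A : Set ℓ} (m : ℕ) (f : A → X) where

    ι : A → Image (suc m) f
    ι x = f x , ∣ x , refl ∣[ suc m ]

    Image-elim : (P : Image (suc m) f → Set c) → (∀ y → isHLevel (suc (suc m)) (P y)) →
      (∀ x → P (ι x)) → ∀ y → P y
    Image-elim P hP d (z , t) = ∥∥-elim (suc m) (λ t → P (z , t)) (λ _ → hP _) (λ { (x , refl) → d x }) t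

    fib-≡↔fib-cong : {x x′ : A} (q : f x ≡ f x′) →
      _≡_ {A = fib f (f x′)} (x , q) (x′ , refl) ↔ fib (cong f {x} {x′}) q
    fib-≡↔fib-cong {x} q = ↔-trans (↔-sym Σ-≡,≡↔≡) (Σ-↔ ↔-refl (subst-≡-refl↔cong-≡ _ q))
      where
        subst-≡-refl↔cong-≡ : ∀ {x′} (r : x ≡ x′) (q : f x ≡ f x′) →
          (subst (λ u → f u ≡ f x′) r q ≡ refl) ↔ (cong f r ≡ q)
        subst-≡-refl↔cong-≡ refl q = sym-↔

    subst-∣∣ : ∀ x {z} (q : f x ≡ z) → subst (λ z → ∥ fib f z ∥[ suc m ]) q ∣ x , refl ∣[ suc m ] ≡ ∣ x , q ∣[ suc m ]
    subst-∣∣ x refl = refl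

    ι-≡↔ : ∀ x x′ → (ι x ≡ ι x′) ↔ Image m (cong f {x} {x′})
    ι-≡↔ x x′ = begin
      ι x ≡ ι x′
        ↔⟨ ↔-sym Σ-≡,≡↔≡ ⟩
      Σ (f x ≡ f x′) (λ q → subst _ q ∣ x , refl ∣[ suc m ] ≡ ∣ x′ , refl ∣[ suc m ])
        ↔⟨ Σ-↔ ↔-refl (≡-pre-↔ (subst-∣∣ x _)) ⟩
      Σ (f x ≡ f x′) (λ q → ∣ x , q ∣[ suc m ] ≡ ∣ x′ , refl ∣[ suc m ])
        ↔⟨ Σ-↔ ↔-refl (∣∣-≡↔ m _ _) ⟩
      Σ (f x ≡ f x′) (λ q → ∥ (x , q) ≡ (x′ , refl) ∥[ m ])
        ↔⟨ Σ-↔ ↔-refl (∥∥-cong-↔ m (fib-≡↔fib-cong _)) ⟩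
      Image m (cong f) ∎
      where open EquationalReasoning

    Image-isLocallySmall : (∀ x x′ → EssSmall (Image m (cong f {x} {x′}))) → LocSmall ℓ (fin 1) (Image (suc m) f)
    Image-isLocallySmall small =
      Image-elim (λ y → ∀ y′ → EssSmall (y ≡ y′)) (λ _ → Π-isHLevel _ λ _ → EssSmall-isHLevel) λ x →
      Image-elim (λ y′ → EssSmall (ι x ≡ y′)) (λ _ → EssSmall-isHLevel) λ x′ →
      EssSmall-↔ (↔-sym (ι-≡↔ x x′)) (small x x′)
      where
        EssSmall-isHLevel : {Y : Set (ℓ ⊔ b)} → isHLevel (suc (suc m)) (EssSmall Y)
        EssSmall-isHLevel = isProp⇒isHLevel-suc (suc m) (EssSmall-isProp ℓ)

    -- Every point of Image (suc m) f merely lies in the range of ι, so the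
    -- embedding of the small image of ι is onto.
    SmallImage-ι⇒isEssSmall : SmallImage ι → EssSmall (Image (suc m) f)
    SmallImage-ι⇒isEssSmall (I , s , e , _ , e-emb , e∘s≡ι) =
      I , e , λ y → isProp⇒inhabited⇒isContr (e-emb y) (e-fib y)
      where
        e-fib : ∀ y → fib e y
        e-fib = Image-elim (fib e) (λ y → isProp⇒isHLevel-suc (suc m) (e-emb y)) λ x → s x , e∘s≡ι x

  Image-isEssSmall : ∀ m {X : Set b} → LocSmall ℓ (fin (suc m)) X → (A : Set ℓ) (f : A → X) → EssSmall (Image m f)
  Image-isEssSmall zero    lsX A f = SmallImage⇒propImage-isEssSmall (SI A _ lsX f)
  Image-isEssSmall (suc m) lsX A f = SmallImage-ι⇒isEssSmall m f (SI A _ (Image-isLocallySmall m f small) (ι m f))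
    where
      small : ∀ x x′ → EssSmall (Image m (cong f {x} {x′}))
      small x x′ = Image-isEssSmall m (lsX (f x) (f x′)) (x ≡ x′) (cong f)

module Replacement (fe : FunExt) (univ : Univalence) (Tr : Truncations) {ℓ ℓV : Level}
                   (SI : SmallImages Tr ℓ) {V : Set ℓV} where
  open TruncationProperties fe univ Tr
  open Images fe univ Tr SI

  module _ {n : ℕ∞} (sup : Tⁿ ℓ n V ≃ V) where

    ∈-sup-↔ : (t : Tⁿ ℓ n V) (z : V) → _∈_ {ℓ} {ℓV} {n} sup z (proj₁ sup t) ↔ fib (proj₁ (proj₂ t)) z
    ∈-sup-↔ t z = subst-↔ (λ t → fib (proj₁ (proj₂ t)) z) (sup⁻¹-sup t)
      where
        sup⁻¹-sup : (t : Tⁿ ℓ n V) → sup⁻¹ {ℓ} {ℓV} {n} sup (proj₁ sup t) ≡ t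
        sup⁻¹-sup t = cong proj₁ (proj₂ (proj₂ sup (proj₁ sup t)) (t , refl))

    Index : V → Set ℓ
    Index a = proj₁ (sup⁻¹ {ℓ} {ℓV} {n} sup a)

    El-↔ : (a : V) → Index a ↔ El {ℓ} {ℓV} {n} sup a
    El-↔ a = total-fib-↔ (proj₁ (proj₂ (sup⁻¹ {ℓ} {ℓV} {n} sup a)))

    replacement-fin : ∀ m → fin m ≤∞ n → LocSmall ℓ (fin (suc m)) V → HasReplacement n V Tr sup (fin m)
    replacement-fin m m≤n lsV a f = proj₁ sup t , λ z → ↔⇒≃ (begin
      _∈_ {ℓ} {ℓV} {n} sup z (proj₁ sup t)  ↔⟨ ∈-sup-↔ t z ⟩
      fib g z                              ↔⟨ fib-proj₁∘-↔ φ z ⟩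
      ∥ fib f̃ z ∥[ m ]                     ↔⟨ ∥∥-cong-↔ m (fib-∘-↔ (El-↔ a) f z) ⟩
      ∥ fib f z ∥[ m ]                     ∎)
      where
        open EquationalReasoning
        f̃ : Index a → V
        f̃ = f ∘ Inverse.to (El-↔ a)
        small : EssSmall (Image m f̃)
        small = Image-isEssSmall m lsV _ f̃
        φ : proj₁ small ≃ Image m f̃
        φ = proj₂ small
        g : proj₁ small → V
        g = proj₁ ∘ proj₁ φ
        t : Tⁿ ℓ n V
        t = proj₁ small , g , λ z →
          isHLevel-suc⇒is[-1]Type n m≤n (isHLevel-↔ (suc m) (fib-proj₁∘-↔ φ z) (∥∥-isHLevel _ m))

  replacement-∞ : (sup : Tⁿ ℓ ∞ V ≃ V) → HasReplacement ∞ V Tr sup ∞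
  replacement-∞ sup a f = proj₁ sup t , λ z → ↔⇒≃ (↔-trans (∈-sup-↔ {∞} sup t z) (fib-∘-↔ (El-↔ {∞} sup a) f z))
    where
      t : Tⁿ ℓ ∞ V
      t = Index {∞} sup a , f ∘ Inverse.to (El-↔ {∞} sup a) , λ _ → tt

mainTheorem4 : FunExt → Univalence → (Tr : Truncations) → ∀ {ℓ ℓV} → SmallImages Tr ℓ →
    (n : ℕ∞) (V : Set ℓV) (sup : (Tⁿ ℓ n V) ≃ V) (k : ℕ∞) → k ≤∞ n →
    LocSmall ℓ (suc∞ k) V → HasReplacement n V Tr sup k
mainTheorem4 fe univ Tr SI (fin _) V sup ∞       (lift ()) _
mainTheorem4 fe univ Tr SI ∞       V sup ∞       _         _   = replacement-∞ sup
  where open Replacement fe univ Tr SI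
mainTheorem4 fe univ Tr SI n       V sup (fin m) m≤n       lsV = replacement-fin sup m m≤n lsV
  where open Replacement fe univ Tr SI
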